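{- Let $T$ be a consistent recursively enumerable theory in the language of arithmetic extending Robinson's arithmetic $Q$, whose provability predicate $\mathrm{Pr}_T$ satisfies the Hilbert–Bernays–Löb derivability conditions and for which Gödel's second incompleteness theorem holds for $T$ and all its finite extensions. If $\psi$ is a sentence with $T\vdash \psi\leftrightarrow(\mathrm{Pr}_T(\#\psi)\vee\mathrm{Pr}_T(\#\neg\psi))$, then $T\vdash\psi$; in particular $\mathbb{N}\vDash\mathrm{Pr}_T(\#\psi)\vee\mathrm{Pr}_T(\#\neg\psi)$, i.e. the predicate "is $T$-decidable" is self-fulfilling with respect to $T$.
   Context: $\mathbb{N}$ is the standard model of arithmetic. For a formula $\sigma$, $\#\sigma$ denotes the canonical numeral for its Gödel number; $\mathrm{Pr}_T(x)$ is an arithmetized provability predicate for $T$ with $\mathbb{N}\vDash\mathrm{Pr}_T(\#\sigma)$ iff $T\vdash\sigma$. A sentence $\psi$ says (with respect to $T$) about itself that it is a $\Delta$, for a formula $\Delta(x)$ with one free variable, iff $T\vdash\psi\leftrightarrow\Delta(\#\psi)$. A predicate $\Delta$ is self-fulfilling with respect to $T$ iff every sentence $\psi$ that says with respect to $T$ about itself that it is a $\Delta$ satisfies $\mathbb{N}\vDash\Delta(\#\psi)$. -}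

module Defs where

open import Data.Nat using (ℕ; zero; suc; _+_; _*_; _^_)
open import Data.Fin using (Fin; toℕ)
import Data.Fin as F
open import Data.List using (List; []; _∷_; map)
open import Data.List.Membership.Propositional using (_∈_)
open import Data.List.Relation.Unary.All using (All)
open import Data.Maybe using (Maybe; just)
open import Data.Product using (Σ; _×_; _,_; ∃)
open import Data.Sum using (_⊎_)
open import Data.Empty using (⊥)
open import Relation.Binary.PropositionalEquality using (_≡_)

infixr 6 _∧'_
infixr 5 _∨'_
infixr 4 _⇒'_ _⇔'_
infix 7 _≐_
infixl 8 _+'_
infixl 9 _*'_
infix 3 _⊢ₜ_
infix 10 _⟨_⟩
infix 2 ℕ⊨_
infixl 4 _+ₜ_

data Term (n : ℕ) : Set where
  var  : Fin n → Term n
  zer  : Term n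
  suc' : Term n → Term n
  _+'_ : Term n → Term n → Term n
  _*'_ : Term n → Term n → Term n

data Formula (n : ℕ) : Set where
  _≐_  : Term n → Term n → Formula n
  ⊥'   : Formula n
  _⇒'_ : Formula n → Formula n → Formula n
  _∧'_ : Formula n → Formula n → Formula n
  _∨'_ : Formula n → Formula n → Formula n
  ∀'   : Formula (suc n) → Formula n
  ∃'   : Formula (suc n) → Formula n

¬'_ : ∀ {n} → Formula n → Formula n
¬' φ = φ ⇒' ⊥'

_⇔'_ : ∀ {n} → Formula n → Formula n → Formula n
φ ⇔' ψ = (φ ⇒' ψ) ∧' (ψ ⇒' φ)

Sentence : Set
Sentence = Formula 0

Ren : ℕ → ℕ → Set
Ren n m = Fin n → Fin m

liftR : ∀ {n m} → Ren n m → Ren (suc n) (suc m)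
liftR ρ F.zero    = F.zero
liftR ρ (F.suc i) = F.suc (ρ i)

renT : ∀ {n m} → Ren n m → Term n → Term m
renT ρ (var i)  = var (ρ i)
renT ρ zer      = zer
renT ρ (suc' t) = suc' (renT ρ t)
renT ρ (s +' t) = renT ρ s +' renT ρ t
renT ρ (s *' t) = renT ρ s *' renT ρ t

ren : ∀ {n m} → Ren n m → Formula n → Formula m
ren ρ (s ≐ t)  = renT ρ s ≐ renT ρ t
ren ρ ⊥'       = ⊥'
ren ρ (φ ⇒' ψ) = ren ρ φ ⇒' ren ρ ψ
ren ρ (φ ∧' ψ) = ren ρ φ ∧' ren ρ ψ
ren ρ (φ ∨' ψ) = ren ρ φ ∨' ren ρ ψ
ren ρ (∀' φ)   = ∀' (ren (liftR ρ) φ)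
ren ρ (∃' φ)   = ∃' (ren (liftR ρ) φ)

wk : ∀ {n} → Formula n → Formula (suc n)
wk = ren F.suc

Sub : ℕ → ℕ → Set
Sub n m = Fin n → Term m

liftS : ∀ {n m} → Sub n m → Sub (suc n) (suc m)
liftS σ F.zero    = var F.zero
liftS σ (F.suc i) = renT F.suc (σ i)

subT : ∀ {n m} → Sub n m → Term n → Term m
subT σ (var i)  = σ i
subT σ zer      = zer
subT σ (suc' t) = suc' (subT σ t)
subT σ (s +' t) = subT σ s +' subT σ t
subT σ (s *' t) = subT σ s *' subT σ t

sub : ∀ {n m} → Sub n m → Formula n → Formula m
sub σ (s ≐ t)  = subT σ s ≐ subT σ t
sub σ ⊥'       = ⊥'
sub σ (φ ⇒' ψ) = sub σ φ ⇒' sub σ ψ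
sub σ (φ ∧' ψ) = sub σ φ ∧' sub σ ψ
sub σ (φ ∨' ψ) = sub σ φ ∨' sub σ ψ
sub σ (∀' φ)   = ∀' (sub (liftS σ) φ)
sub σ (∃' φ)   = ∃' (sub (liftS σ) φ)

single : ∀ {n} → Term n → Sub (suc n) n
single t F.zero    = t
single t (F.suc i) = var i

_[_] : ∀ {n} → Formula (suc n) → Term n → Formula n
φ [ t ] = sub (single t) φ

⟦_⟧t : ∀ {n} → Term n → (Fin n → ℕ) → ℕ
⟦ var i  ⟧t e = e i
⟦ zer    ⟧t e = zero
⟦ suc' t ⟧t e = suc (⟦ t ⟧t e)
⟦ s +' t ⟧t e = ⟦ s ⟧t e + ⟦ t ⟧t e
⟦ s *' t ⟧t e = ⟦ s ⟧t e * ⟦ t ⟧t e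

extend : ∀ {n} → ℕ → (Fin n → ℕ) → Fin (suc n) → ℕ
extend a e F.zero    = a
extend a e (F.suc i) = e i

⟦_⟧ : ∀ {n} → Formula n → (Fin n → ℕ) → Set
⟦ s ≐ t  ⟧ e = ⟦ s ⟧t e ≡ ⟦ t ⟧t e
⟦ ⊥'     ⟧ e = ⊥
⟦ φ ⇒' ψ ⟧ e = ⟦ φ ⟧ e → ⟦ ψ ⟧ e
⟦ φ ∧' ψ ⟧ e = ⟦ φ ⟧ e × ⟦ ψ ⟧ e
⟦ φ ∨' ψ ⟧ e = ⟦ φ ⟧ e ⊎ ⟦ ψ ⟧ e
⟦ ∀' φ   ⟧ e = (a : ℕ) → ⟦ φ ⟧ (extend a e)
⟦ ∃' φ   ⟧ e = Σ ℕ λ a → ⟦ φ ⟧ (extend a e)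

ℕ⊨_ : Sentence → Set
ℕ⊨ σ = ⟦ σ ⟧ (λ ())

infix 3 _⊢_

data _⊢_ {n : ℕ} (Γ : List (Formula n)) : Formula n → Set where
  hyp   : ∀ {φ} → φ ∈ Γ → Γ ⊢ φ
  raa   : ∀ {φ} → (¬' φ ∷ Γ) ⊢ ⊥' → Γ ⊢ φ
  ⇒I    : ∀ {φ ψ} → (φ ∷ Γ) ⊢ ψ → Γ ⊢ φ ⇒' ψ
  ⇒E    : ∀ {φ ψ} → Γ ⊢ φ ⇒' ψ → Γ ⊢ φ → Γ ⊢ ψ
  ∧I    : ∀ {φ ψ} → Γ ⊢ φ → Γ ⊢ ψ → Γ ⊢ φ ∧' ψ
  ∧E₁   : ∀ {φ ψ} → Γ ⊢ φ ∧' ψ → Γ ⊢ φ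
  ∧E₂   : ∀ {φ ψ} → Γ ⊢ φ ∧' ψ → Γ ⊢ ψ
  ∨I₁   : ∀ {φ ψ} → Γ ⊢ φ → Γ ⊢ φ ∨' ψ
  ∨I₂   : ∀ {φ ψ} → Γ ⊢ ψ → Γ ⊢ φ ∨' ψ
  ∨E    : ∀ {φ ψ χ} → Γ ⊢ φ ∨' ψ → (φ ∷ Γ) ⊢ χ → (ψ ∷ Γ) ⊢ χ → Γ ⊢ χ
  ∀I    : ∀ {φ} → map wk Γ ⊢ φ → Γ ⊢ ∀' φ
  ∀E    : ∀ {φ} → Γ ⊢ ∀' φ → (t : Term n) → Γ ⊢ φ [ t ]
  ∃I    : ∀ {φ} → (t : Term n) → Γ ⊢ φ [ t ] → Γ ⊢ ∃' φ
  ∃E    : ∀ {φ χ} → Γ ⊢ ∃' φ → (φ ∷ map wk Γ) ⊢ wk χ → Γ ⊢ χ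
  ≐refl : ∀ {t} → Γ ⊢ t ≐ t
  ≐subst : ∀ {φ s t} → Γ ⊢ s ≐ t → Γ ⊢ φ [ s ] → Γ ⊢ φ [ t ]

Theory : Set₁
Theory = Sentence → Set

_⊢ₜ_ : Theory → Sentence → Set
T ⊢ₜ σ = Σ (List Sentence) λ Γ → All T Γ × (Γ ⊢ σ)

Consistent : Theory → Set
Consistent T = T ⊢ₜ ⊥' → ⊥

_+ₜ_ : Theory → Sentence → Theory
(T +ₜ φ) σ = T σ ⊎ σ ≡ φ

-- recursively enumerable: the axiom set is the range of a
-- (necessarily computable, as every Agda function is) enumeration
RecEnum : Theory → Set
RecEnum T = Σ (ℕ → Maybe Sentence) λ e →
  (σ : Sentence) → (T σ → ∃ λ k → e k ≡ just σ) × ((∃ λ k → e k ≡ just σ) → T σ)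

v0 : ∀ {n} → Term (suc n)
v0 = var F.zero

v1 : ∀ {n} → Term (suc (suc n))
v1 = var (F.suc F.zero)

data QAxiom : Sentence → Set where
  Q1 : QAxiom (∀' (¬' (suc' v0 ≐ zer)))
  Q2 : QAxiom (∀' (∀' (suc' v1 ≐ suc' v0 ⇒' v1 ≐ v0)))
  Q3 : QAxiom (∀' (v0 ≐ zer ∨' ∃' (v1 ≐ suc' v0)))
  Q4 : QAxiom (∀' (v0 +' zer ≐ v0))
  Q5 : QAxiom (∀' (∀' (v1 +' suc' v0 ≐ suc' (v1 +' v0))))
  Q6 : QAxiom (∀' (v0 *' zer ≐ zer))
  Q7 : QAxiom (∀' (∀' (v1 *' suc' v0 ≐ v1 *' v0 +' v1)))

ExtendsQ : Theory → Set
ExtendsQ T = (σ : Sentence) → QAxiom σ → T ⊢ₜ σ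

pair : ℕ → ℕ → ℕ
pair a b = 2 ^ a * (2 * b + 1)

codeT : ∀ {n} → Term n → ℕ
codeT (var i)  = pair 0 (toℕ i)
codeT zer      = pair 1 0
codeT (suc' t) = pair 2 (codeT t)
codeT (s +' t) = pair 3 (pair (codeT s) (codeT t))
codeT (s *' t) = pair 4 (pair (codeT s) (codeT t))

code : ∀ {n} → Formula n → ℕ
code (s ≐ t)  = pair 0 (pair (codeT s) (codeT t))
code ⊥'       = pair 1 0
code (φ ⇒' ψ) = pair 2 (pair (code φ) (code ψ))
code (φ ∧' ψ) = pair 3 (pair (code φ) (code ψ))
code (φ ∨' ψ) = pair 4 (pair (code φ) (code ψ))
code (∀' φ)   = pair 5 (code φ)
code (∃' φ)   = pair 6 (code φ)

numeral : ∀ {n} → ℕ → Term n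
numeral zero    = zer
numeral (suc k) = suc' (numeral k)

#_ : ∀ {n} → Formula n → Term 0
# φ = numeral (code φ)

_⟨_⟩ : Formula 1 → Sentence → Sentence
Δ ⟨ σ ⟩ = Δ [ # σ ]

Represents : Theory → Formula 1 → Set
Represents T Pr = (σ : Sentence) → (ℕ⊨ (Pr ⟨ σ ⟩) → T ⊢ₜ σ) × (T ⊢ₜ σ → ℕ⊨ (Pr ⟨ σ ⟩))

record HBL (T : Theory) (Pr : Formula 1) : Set where
  field
    D1 : (σ : Sentence) → T ⊢ₜ σ → T ⊢ₜ Pr ⟨ σ ⟩
    D2 : (σ τ : Sentence) → T ⊢ₜ (Pr ⟨ σ ⇒' τ ⟩ ⇒' (Pr ⟨ σ ⟩ ⇒' Pr ⟨ τ ⟩))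
    D3 : (σ : Sentence) → T ⊢ₜ (Pr ⟨ σ ⟩ ⇒' Pr ⟨ Pr ⟨ σ ⟩ ⟩)

-- Gödel's second incompleteness theorem for T and all its finite
-- extensions T + φ (a finite extension by φ₁,…,φₖ is T + (φ₁ ∧ … ∧ φₖ)),
-- where Con(T + φ) is ¬ Pr_T(#¬φ).
G2FiniteExt : Theory → Formula 1 → Set
G2FiniteExt T Pr = (φ : Sentence) → Consistent (T +ₜ φ) →
  (T +ₜ φ) ⊢ₜ ¬' (Pr ⟨ ¬' φ ⟩) → ⊥

SaysOfItself : Theory → Formula 1 → Sentence → Set
SaysOfItself T Δ ψ = T ⊢ₜ (ψ ⇔' Δ ⟨ ψ ⟩)

{-# OPTIONS --safe #-}
module Submission where

-- If ψ ↔ (Pr ψ ∨ Pr ¬ψ), then ψ follows from Pr ψ, hence ¬ψ implies ¬Pr ψ,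
-- and since Pr ¬¬ψ → Pr ψ by the derivability conditions, T + ¬ψ proves
-- ¬Pr ¬¬ψ, i.e. its own consistency. By the second incompleteness theorem
-- T + ¬ψ is inconsistent, so T ⊢ ψ.

open import Defs
open import Level using (0ℓ)
open import Axiom.ExcludedMiddle using (ExcludedMiddle)
open import Data.Product using (Σ; _×_; _,_; proj₂)
open import Data.Sum using (inj₁; inj₂)
open import Data.Empty using (⊥-elim)
open import Data.List using (List; []; _∷_; _++_)
open import Data.List.Relation.Unary.Any using (here; there)
open import Data.List.Relation.Unary.All using (All; []; _∷_) renaming (map to All-map)
open import Data.List.Relation.Unary.All.Properties using (++⁺)
open import Data.List.Relation.Binary.Subset.Propositional using (_⊆_)
open import Data.List.Relation.Binary.Subset.Propositional.Properties
  using (⊆-trans; ∷⁺ʳ; ∈-∷⁺ʳ; xs⊆x∷xs; xs⊆xs++ys; xs⊆ys++xs)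
  renaming (map⁺ to ⊆-map⁺)
open import Relation.Binary.PropositionalEquality using (refl)
open import Relation.Nullary using (yes; no)

⊢-weaken : ∀ {n} {Γ Δ : List (Formula n)} {φ} → Γ ⊆ Δ → Γ ⊢ φ → Δ ⊢ φ
⊢-weaken Γ⊆Δ (hyp φ∈Γ)     = hyp (Γ⊆Δ φ∈Γ)
⊢-weaken Γ⊆Δ (raa d)       = raa (⊢-weaken (∷⁺ʳ _ Γ⊆Δ) d)
⊢-weaken Γ⊆Δ (⇒I d)        = ⇒I (⊢-weaken (∷⁺ʳ _ Γ⊆Δ) d)
⊢-weaken Γ⊆Δ (⇒E d e)      = ⇒E (⊢-weaken Γ⊆Δ d) (⊢-weaken Γ⊆Δ e)
⊢-weaken Γ⊆Δ (∧I d e)      = ∧I (⊢-weaken Γ⊆Δ d) (⊢-weaken Γ⊆Δ e)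
⊢-weaken Γ⊆Δ (∧E₁ d)       = ∧E₁ (⊢-weaken Γ⊆Δ d)
⊢-weaken Γ⊆Δ (∧E₂ d)       = ∧E₂ (⊢-weaken Γ⊆Δ d)
⊢-weaken Γ⊆Δ (∨I₁ d)       = ∨I₁ (⊢-weaken Γ⊆Δ d)
⊢-weaken Γ⊆Δ (∨I₂ d)       = ∨I₂ (⊢-weaken Γ⊆Δ d)
⊢-weaken Γ⊆Δ (∨E d e f)    =
  ∨E (⊢-weaken Γ⊆Δ d) (⊢-weaken (∷⁺ʳ _ Γ⊆Δ) e) (⊢-weaken (∷⁺ʳ _ Γ⊆Δ) f)
⊢-weaken Γ⊆Δ (∀I d)        = ∀I (⊢-weaken (⊆-map⁺ wk Γ⊆Δ) d)
⊢-weaken Γ⊆Δ (∀E d t)      = ∀E (⊢-weaken Γ⊆Δ d) t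
⊢-weaken Γ⊆Δ (∃I t d)      = ∃I t (⊢-weaken Γ⊆Δ d)
⊢-weaken Γ⊆Δ (∃E d e)      = ∃E (⊢-weaken Γ⊆Δ d) (⊢-weaken (∷⁺ʳ _ (⊆-map⁺ wk Γ⊆Δ)) e)
⊢-weaken Γ⊆Δ ≐refl         = ≐refl
⊢-weaken Γ⊆Δ (≐subst d e)  = ≐subst (⊢-weaken Γ⊆Δ d) (⊢-weaken Γ⊆Δ e)

⊢-dne : ∀ {n} {Γ : List (Formula n)} {φ} → Γ ⊢ ¬' ¬' φ ⇒' φ
⊢-dne = ⇒I (raa (⇒E (hyp (there (here refl))) (hyp (here refl))))

⊢-⇒-trans : ∀ {n} {Γ : List (Formula n)} {φ ψ χ} →
  Γ ⊢ (φ ⇒' ψ) ⇒' (ψ ⇒' χ) ⇒' (φ ⇒' χ)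
⊢-⇒-trans = ⇒I (⇒I (⇒I (⇒E (hyp (there (here refl)))
                          (⇒E (hyp (there (there (here refl)))) (hyp (here refl))))))

module _ {T : Theory} where

  ⊢ₜ-logic : ∀ {σ} → [] ⊢ σ → T ⊢ₜ σ
  ⊢ₜ-logic d = [] , [] , d

  ⊢ₜ-mp : ∀ {σ τ} → T ⊢ₜ σ ⇒' τ → T ⊢ₜ σ → T ⊢ₜ τ
  ⊢ₜ-mp (Γ , T-Γ , d) (Δ , T-Δ , e) =
    Γ ++ Δ , ++⁺ T-Γ T-Δ ,
    ⇒E (⊢-weaken (xs⊆xs++ys Γ Δ) d) (⊢-weaken (xs⊆ys++xs Δ Γ) e)

  ⊢ₜ-∧E₂ : ∀ {σ τ} → T ⊢ₜ σ ∧' τ → T ⊢ₜ τ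
  ⊢ₜ-∧E₂ (Γ , T-Γ , d) = Γ , T-Γ , ∧E₂ d

  ⊢ₜ-∨I₁ : ∀ {σ τ} → T ⊢ₜ σ ⇒' σ ∨' τ
  ⊢ₜ-∨I₁ = ⊢ₜ-logic (⇒I (∨I₁ (hyp (here refl))))

  ⊢ₜ-∘ : ∀ {σ τ ρ} → T ⊢ₜ τ ⇒' ρ → T ⊢ₜ σ ⇒' τ → T ⊢ₜ σ ⇒' ρ
  ⊢ₜ-∘ g f = ⊢ₜ-mp (⊢ₜ-mp (⊢ₜ-logic ⊢-⇒-trans) f) g

  ⊢ₜ-contrapose : ∀ {σ τ} → T ⊢ₜ σ ⇒' τ → T ⊢ₜ ¬' τ ⇒' ¬' σ
  ⊢ₜ-contrapose = ⊢ₜ-mp (⊢ₜ-logic ⊢-⇒-trans)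

  ⊢ₜ-+ₜ : ∀ {φ σ} → T ⊢ₜ σ → (T +ₜ φ) ⊢ₜ σ
  ⊢ₜ-+ₜ (Γ , T-Γ , d) = Γ , All-map inj₁ T-Γ , d

  +ₜ-⊢ₜ-axiom : ∀ {φ} → (T +ₜ φ) ⊢ₜ φ
  +ₜ-⊢ₜ-axiom {φ} = φ ∷ [] , inj₂ refl ∷ [] , hyp (here refl)

  +ₜ-axioms-split : ∀ {φ} (Γ : List Sentence) → All (T +ₜ φ) Γ →
    Σ (List Sentence) λ Γ′ → All T Γ′ × Γ ⊆ φ ∷ Γ′
  +ₜ-axioms-split []      []              = [] , [] , λ ()
  +ₜ-axioms-split (σ ∷ Γ) (inj₁ T-σ ∷ ax) with +ₜ-axioms-split Γ ax
  ... | Γ′ , T-Γ′ , Γ⊆ =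
    σ ∷ Γ′ , T-σ ∷ T-Γ′ , ∈-∷⁺ʳ (there (here refl)) (⊆-trans Γ⊆ (∷⁺ʳ _ (xs⊆x∷xs Γ′ σ)))
  +ₜ-axioms-split (σ ∷ Γ) (inj₂ refl ∷ ax) with +ₜ-axioms-split Γ ax
  ... | Γ′ , T-Γ′ , Γ⊆ = Γ′ , T-Γ′ , ∈-∷⁺ʳ (here refl) Γ⊆

  ⊢ₜ-deduction : ∀ {φ σ} → (T +ₜ φ) ⊢ₜ σ → T ⊢ₜ φ ⇒' σ
  ⊢ₜ-deduction (Γ , ax , d) with +ₜ-axioms-split Γ ax
  ... | Γ′ , T-Γ′ , Γ⊆ = Γ′ , T-Γ′ , ⇒I (⊢-weaken Γ⊆ d)

  module _ {Pr : Formula 1} (hbl : HBL T Pr) where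
    open HBL hbl

    Pr-mono : ∀ σ τ → T ⊢ₜ σ ⇒' τ → T ⊢ₜ Pr ⟨ σ ⟩ ⇒' Pr ⟨ τ ⟩
    Pr-mono σ τ σ⇒τ = ⊢ₜ-mp (D2 σ τ) (D1 (σ ⇒' τ) σ⇒τ)

  -- G2 only shows ¬ Consistent (T + φ); excluded middle extracts a derivation of ⊥.
  G2-refutes : ∀ {Pr φ} → ExcludedMiddle 0ℓ → G2FiniteExt T Pr →
    (T +ₜ φ) ⊢ₜ ¬' Pr ⟨ ¬' φ ⟩ → T ⊢ₜ ¬' φ
  G2-refutes {φ = φ} em g2 proves-Con with em {(T +ₜ φ) ⊢ₜ ⊥'}
  ... | yes inconsistent = ⊢ₜ-deduction inconsistent
  ... | no consistent    = ⊥-elim (g2 φ consistent proves-Con)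

mainTheorem5 : ExcludedMiddle 0ℓ →
    (T : Theory) (Pr : Formula 1) →
    Consistent T → RecEnum T → ExtendsQ T →
    Represents T Pr → HBL T Pr → G2FiniteExt T Pr →
    (ψ : Sentence) →
    T ⊢ₜ (ψ ⇔' (Pr ⟨ ψ ⟩ ∨' Pr ⟨ ¬' ψ ⟩)) →
    (T ⊢ₜ ψ) × ℕ⊨ (Pr ⟨ ψ ⟩ ∨' Pr ⟨ ¬' ψ ⟩)
mainTheorem5 em T Pr _ _ _ rep hbl g2 ψ ψ-says-decidable =
  T⊢ψ , inj₁ (proj₂ (rep ψ) T⊢ψ)
  where
  Pr¬¬ψ⇒ψ : T ⊢ₜ Pr ⟨ ¬' ¬' ψ ⟩ ⇒' ψ
  Pr¬¬ψ⇒ψ = ⊢ₜ-∘ (⊢ₜ-∧E₂ ψ-says-decidable)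
              (⊢ₜ-∘ ⊢ₜ-∨I₁ (Pr-mono hbl (¬' ¬' ψ) ψ (⊢ₜ-logic ⊢-dne)))

  ¬ψ-proves-own-Con : (T +ₜ ¬' ψ) ⊢ₜ ¬' Pr ⟨ ¬' ¬' ψ ⟩
  ¬ψ-proves-own-Con = ⊢ₜ-mp (⊢ₜ-+ₜ (⊢ₜ-contrapose Pr¬¬ψ⇒ψ)) +ₜ-⊢ₜ-axiom

  T⊢ψ : T ⊢ₜ ψ
  T⊢ψ = ⊢ₜ-mp (⊢ₜ-logic ⊢-dne) (G2-refutes em g2 ¬ψ-proves-own-Con)
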